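{- Let $\mathcal T$ be the top tree of a rooted ordered labeled tree $T$ produced by the greedy construction. For any node $c$ of $\mathcal T$ corresponding to a cluster $C$ of $T$, the number of nodes of the subtree $\mathcal T(c)$ of $\mathcal T$ rooted at $c$ is $O(|C|)$, where $|C|$ is the number of nodes of the tree pattern $C$.
   Context: A labeled tree $T$ is a rooted, ordered tree each of whose nodes carries a label; $p(v)$ denotes the parent of $v$. Clusters. For a node $v$ with children $v_1,\dots,v_k$ (left to right), $T(v)$ is the subtree consisting of $v$ and its descendants, $F(v)$ the forest of proper descendants of $v$, and for $1\le s\le r\le k$, $T(v,v_s,v_r)$ is the tree pattern induced by $\{v\}\cup T(v_s)\cup\dots\cup T(v_r)$. A cluster with top boundary node $v$ is either a pattern $T(v,v_s,v_r)$ (no bottom boundary node) or a pattern $T(v,v_s,v_r)\setminus F(u)$ for a node $u$ of $T(v_s)\cup\dots\cup T(v_r)$ ($u$ is its bottom boundary node). A single edge $(v,p(v))$ is a cluster with top boundary $p(v)$, and with bottom boundary $v$ unless $v$ is a leaf of $T$. Two edge-disjoint clusters $A,B$ sharing one boundary node can be merged into $C=A\cup B$ (when $C$ is a cluster) in five ways: vertical merges, where the bottom boundary node of $A$ is the top boundary node of $B$ and $B$ contains all children of this node (allowed only if this node is a boundary node of no cluster other than $A,B$): type (a) if $B$ has a bottom boundary node, type (b) if not; horizontal merges, where $A,B$ have the same top boundary node, $A$ left of $B$, and at least one of them has no bottom boundary node: type (c) if only $A$ has a bottom boundary node, (d) if only $B$ has one, (e) if neither has one. $A$ is always the cluster first visited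 in a preorder traversal of $T$. Top tree. A top tree of $T$ is an ordered rooted binary labeled tree whose nodes correspond to clusters: the root to $T$, the leaves to the edges of $T$ (labeled by the pair (label of parent endpoint, label of child endpoint)), and each internal node to the merge of its left child's cluster $A$ and right child's cluster $B$, labeled by the merge type (a)–(e). Greedy construction. Maintain an auxiliary rooted ordered tree $\tilde T$, initially $T$, whose edges correspond to the current roots of the partial top tree (initially the edges of $T$). Merging edges $(u,v),(v,w)$ of $\tilde T$ creates a new top tree node whose children are the two corresponding clusters; if $v$ is the parent of $u$ and the only child of $w$ (vertical merge) the two edges are replaced by $(u,w)$; if $v$ is the parent of both $u,w$ and one of $u,w$ is a leaf (horizontal merge) they are replaced by a single edge from $v$ to one of $u,w$ (the non-leaf one, if any). While $\tilde T$ has more than one edge, do an iteration: Step 1 (horizontal): for each node $v$ of $\tilde T$ with children $v_1,\dots,v_k$, $k\ge 2$, for $i=1,\dots,\lfloor k/2\rfloor$ merge $(v,v_{2i-1}),(v,v_{2i})$ if $v_{2i-1}$ or $v_{2i}$ is a leaf; if $k$ is odd, $v_k$ is a leaf and $v_{k-2},v_{k-1}$ are non-leaves, also merge $(v,v_{k-1}),(v,v_k)$. Step 2 (vertical): for each maximal path $v_1,\dots,v_p$ with $v_{i+1}$ the parent of $v_i$ and $v_2,\dots,v_{p-1}$ each having exactly one child, with $e_i=(v_i,v_{i+1})$: if $p$ is even merge $\{e_1,e_2\},\{e_3,e_4\},\dots,\{e_{p-3},e_{p-2}\}$; if $p$ is odd merge $\{e_1,e_2\},\dots,\{e_{p-4},e_{p-3}\}$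 and also $\{e_{p-2},e_{p-1}\}$ if $e_{p-1}$ was not merged in Step 1. -}

module Defs where

open import Data.Nat using (ℕ; zero; suc; _+_; _≟_)
open import Data.Bool using (Bool; true; false; if_then_else_; not; _∧_)
open import Data.List using (List; []; _∷_; length; deduplicate; _++_; [_])
open import Data.List.NonEmpty using (List⁺; _∷⁺_) renaming (_∷_ to _∷₁_)
open import Data.Maybe using (Maybe; just; nothing)
open import Data.Product using (_×_; _,_; proj₁)

data Tree (L : Set) : Set where
  node : L → List (Tree L) → Tree L

mutual
  treeSize : {L : Set} → Tree L → ℕ
  treeSize (node _ ts) = suc (forestSize ts)

  forestSize : {L : Set} → List (Tree L) → ℕ
  forestSize [] = 0
  forestSize (t ∷ ts) = treeSize t + forestSize ts

data MergeType : Set where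
  typeA typeB typeC typeD typeE : MergeType

-- A leaf is an edge (v , p(v)) of T; it is labeled by
-- (label of parent endpoint , label of child endpoint).  In addition we
-- record the identities (preorder numbers in T) of the two endpoints, so
-- that the cluster of T corresponding to a top tree node is determined.
data TopTree (L : Set) : Set where
  leaf  : (parentId : ℕ) (parentLabel : L) (childId : ℕ) (childLabel : L) → TopTree L
  merge : MergeType → TopTree L → TopTree L → TopTree L

module _ {L : Set} where

  topSize : TopTree L → ℕ
  topSize (leaf _ _ _ _) = 1
  topSize (merge _ A B) = suc (topSize A + topSize B)

  endpoints : TopTree L → List ℕ
  endpoints (leaf p _ c _) = p ∷ c ∷ []
  endpoints (merge _ A B) = endpoints A ++ endpoints B

  clusterSize : TopTree L → ℕ
  clusterSize t = length (deduplicate _≟_ (endpoints t))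

  -- c ⊑ 𝒯 : c is (the subtree rooted at) a node of 𝒯
  data _⊑_ : TopTree L → TopTree L → Set where
    here  : ∀ {t} → t ⊑ t
    left  : ∀ {t m A B} → t ⊑ A → t ⊑ merge m A B
    right : ∀ {t m A B} → t ⊑ B → t ⊑ merge m A B

-- Each edge from a node to a child carries the
-- cluster (root of the partial top tree) it corresponds to and a flag
-- recording whether the edge was produced by a merge in Step 1 of the
-- current iteration.

data Aux (L : Set) : Set where
  anode : List (TopTree L × Bool × Aux L) → Aux L

module Greedy {L : Set} where

  AEdge : Set
  AEdge = TopTree L × Bool × Aux L

  isLeaf : Aux L → Bool
  isLeaf (anode []) = true
  isLeaf (anode (_ ∷ _)) = false

  mutual
    -- the node with id n, label l and children ts;
    -- returns its T̃-node and the next free id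
    initN : ℕ → L → List (Tree L) → Aux L × ℕ
    initN n l ts with initF n l (suc n) ts
    ... | es , m = anode es , m

    initF : ℕ → L → ℕ → List (Tree L) → List AEdge × ℕ
    initF p pl n [] = [] , n
    initF p pl n (node l ts ∷ rest) with initN n l ts
    ... | a , m with initF p pl m rest
    ...   | es , k = (leaf p pl n l , false , a) ∷ es , k

  initAux : Tree L → Aux L
  initAux (node l ts) = proj₁ (initN 0 l ts)

  -- horizontal merge of (v,u₁) [cluster A] and (v,u₂) [cluster B],
  -- where at least one of u₁,u₂ is a leaf of T̃.  The new edge goes to
  -- the non-leaf one (to u₁ if both are leaves).
  hmerge : AEdge → AEdge → AEdge
  hmerge (A , _ , u₁) (B , _ , u₂) with isLeaf u₁ | isLeaf u₂
  ... | false | _     = merge typeC A B , true , u₁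
  ... | true  | false = merge typeD A B , true , u₂
  ... | true  | true  = merge typeE A B , true , u₁

  hpair : AEdge → AEdge → List AEdge
  hpair x@(_ , _ , u₁) y@(_ , _ , u₂) with isLeaf u₁ | isLeaf u₂
  ... | false | false = x ∷ y ∷ []
  ... | _     | _     = [ hmerge x y ]

  nonLeafE : AEdge → Bool
  nonLeafE (_ , _ , u) = not (isLeaf u)

  step1L : List AEdge → List AEdge
  step1L [] = []
  step1L (x ∷ []) = x ∷ []
  step1L (x ∷ y ∷ []) = hpair x y
  step1L (x ∷ y ∷ z ∷ []) =
    if nonLeafE x ∧ nonLeafE y ∧ not (nonLeafE z)
    then x ∷ [ hmerge y z ]
    else hpair x y ++ [ z ]
  step1L (x ∷ y ∷ rest@(_ ∷ _ ∷ _)) = hpair x y ++ step1L rest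

  mutual
    step1 : Aux L → Aux L
    step1 (anode es) = anode (step1L (step1Es es))

    step1Es : List AEdge → List AEdge
    step1Es [] = []
    step1Es ((K , _ , a) ∷ es) = (K , false , step1 a) ∷ step1Es es

  -- type of the vertical merge of A (upper edge) and B (lower edge);
  -- b? says whether the lower endpoint of B is a non-leaf of T̃,
  -- i.e. whether B has a bottom boundary node
  vtype : Bool → MergeType
  vtype true  = typeA
  vtype false = typeB

  -- edges e₁ , e₂ , … , e_{p-1} of a maximal path, bottom to top
  -- (given as first edge and the rest), with their Step-1 flags;
  -- the Bool says whether v₁ is a non-leaf.  Result: the new clusters
  -- of the path, bottom to top.
  vm : Bool → TopTree L × Bool → List (TopTree L × Bool) → List⁺ (TopTree L)
  vm b (B , _) [] = B ∷₁ []
  vm b (B , _) ((A , fA) ∷ []) =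
    if fA then B ∷₁ A ∷ [] else merge (vtype b) A B ∷₁ []
  vm b (B , _) ((A , _) ∷ x ∷ rest) = merge (vtype b) A B ∷⁺ vm true x rest

  rebuild : TopTree L → List (TopTree L) → Aux L → AEdge
  rebuild c [] bot = c , false , bot
  rebuild c (c' ∷ cs) bot = rebuild c' cs (anode [ (c , false , bot) ])

  rebuild⁺ : List⁺ (TopTree L) → Aux L → AEdge
  rebuild⁺ (c ∷₁ cs) bot = rebuild c cs bot

  mutual
    -- a node w that is the top of maximal paths (the root, or a node
    -- with ≠ 1 children): each child edge starts a maximal path
    step2 : Aux L → Aux L
    step2 (anode es) = anode (step2Es es)

    step2Es : List AEdge → List AEdge
    step2Es [] = []
    step2Es ((K , f , a) ∷ es) = chain (K , f) [] a ∷ step2Es es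

    -- walk down the path; accumulated edges bottom-first
    chain : TopTree L × Bool → List (TopTree L × Bool) → Aux L → AEdge
    chain e acc (anode ((K , f , a) ∷ [])) = chain (K , f) (e ∷ acc) a
    chain e acc (anode es) =
      rebuild⁺ (vm (not (isLeaf (anode es))) e acc) (anode (step2Es es))

  iteration : Aux L → Aux L
  iteration a = step2 (step1 a)

  -- iterate while T̃ has more than one edge; the fuel is the number of
  -- nodes of T (each iteration removes at least one edge)
  run : ℕ → Aux L → Maybe (TopTree L)
  run _ (anode ((K , _ , anode []) ∷ [])) = just K
  run zero _ = nothing
  run (suc n) a = run n (iteration a)

-- The top tree of T produced by the greedy construction
-- (nothing iff T has no edge).
greedyTopTree : {L : Set} → Tree L → Maybe (TopTree L)
greedyTopTree T = Greedy.run (treeSize T) (Greedy.initAux T)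

module Submission where

-- Every leaf of a top tree is an edge (v , p(v)) of T; call v its lower
-- endpoint.  A top tree is a full binary tree, so a cluster built from k
-- edges has 2k - 1 top tree nodes.  If the k edges have pairwise distinct
-- lower endpoints, these are k distinct nodes of the cluster, hence
-- k ≤ |C| and |𝒯(c)| < 2|C|.  The proof therefore reduces to one invariant
-- of the greedy construction: the lower endpoints of the edges of the
-- final top tree are pairwise distinct.
--
-- It then shows that
-- Step 1, Step 2, and hence the whole run, only permute the lower
-- endpoints stored in the auxiliary tree T̃, which are initially the
-- (ascending, hence distinct) preorder numbers of the non-root nodes of T.

open import Defs
open import Data.Nat using (ℕ; _≤_; _*_)
open import Data.Product using (Σ)
open import Data.Maybe using (just)
open import Relation.Binary.PropositionalEquality using (_≡_)

open import Data.Nat using (zero; suc; _+_; _≟_)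
open import Data.Nat.Properties
  using (≤-refl; ≤-trans; <⇒≢; n≤1+n; m≤n⇒m≤1+n; +-suc; *-distribˡ-+; *-monoʳ-≤; module ≤-Reasoning)
open import Data.Fin using (Fin)
import Data.Fin as Fin
open import Data.Fin.Properties using (injective⇒≤)
open import Data.List using (List; []; _∷_; _++_; [_]; length; lookup; deduplicate)
open import Data.List.Properties using (length-++; ++-assoc)
open import Data.List.NonEmpty using (List⁺; _∷⁺_) renaming (_∷_ to _∷₁_)
open import Data.Product using (_×_; _,_; proj₁; proj₂)
open import Data.Sum using (inj₁; inj₂)
open import Data.Bool using (Bool; true; false)
open import Data.Empty using (⊥-elim)
open import Relation.Binary.PropositionalEquality using (refl; sym; cong; cong₂; setoid; module ≡-Reasoning)
open import Data.List.Relation.Unary.All using (All; []; _∷_)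
import Data.List.Relation.Unary.All as All
import Data.List.Relation.Unary.All.Properties as AllProperties
open import Data.List.Relation.Unary.AllPairs using ([]; _∷_)
open import Data.List.Relation.Unary.Any using (here; there; index)
open import Data.List.Relation.Unary.Any.Properties using (lookup-index)
open import Data.List.Relation.Unary.Unique.Propositional using (Unique)
open import Data.List.Membership.Propositional.Properties using (∈-++⁻; ∈-++⁺ˡ; ∈-++⁺ʳ; ∈-deduplicate⁺; ∈-lookup)
open import Data.List.Relation.Binary.Subset.Propositional using (_⊆_)
open import Data.List.Relation.Binary.Permutation.Propositional
  using (_↭_; ↭-refl; ↭-sym; ↭-trans; ↭⇒↭ₛ; module PermutationReasoning)
open import Data.List.Relation.Binary.Permutation.Propositional.Properties
  using (++⁺; ++⁺ˡ; ++⁺ʳ; ++-commutativeMonoid)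
import Data.List.Relation.Binary.Permutation.Setoid.Properties as PermutationSetoid
open import Algebra.Solver.CommutativeMonoid (++-commutativeMonoid {A = ℕ})
  using (solve; _⊕_; _⊜_; id)

module _ {A : Set} where

  unique-++⁻ˡ : ∀ (xs : List A) {ys} → Unique (xs ++ ys) → Unique xs
  unique-++⁻ˡ [] _ = []
  unique-++⁻ˡ (_ ∷ xs) (x∉ ∷ u) = AllProperties.++⁻ˡ xs x∉ ∷ unique-++⁻ˡ xs u

  unique-++⁻ʳ : ∀ (xs : List A) {ys} → Unique (xs ++ ys) → Unique ys
  unique-++⁻ʳ [] u = u
  unique-++⁻ʳ (_ ∷ xs) (_ ∷ u) = unique-++⁻ʳ xs u

  unique-resp-↭ : ∀ {xs ys : List A} → xs ↭ ys → Unique xs → Unique ys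
  unique-resp-↭ p = PermutationSetoid.Unique-resp-↭ (setoid A) (↭⇒↭ₛ p)

  lookup-injective : ∀ {xs : List A} → Unique xs → ∀ i j → lookup xs i ≡ lookup xs j → i ≡ j
  lookup-injective {_ ∷ _} _         Fin.zero    Fin.zero    _  = refl
  lookup-injective {_ ∷ _} (x∉ ∷ _) Fin.zero    (Fin.suc j) eq = ⊥-elim (All.lookup x∉ (∈-lookup j) eq)
  lookup-injective {_ ∷ _} (x∉ ∷ _) (Fin.suc i) Fin.zero    eq = ⊥-elim (All.lookup x∉ (∈-lookup i) (sym eq))
  lookup-injective {_ ∷ _} (_ ∷ u)   (Fin.suc i) (Fin.suc j) eq = cong Fin.suc (lookup-injective u i j eq)

  -- Pigeonhole: a duplicate-free list contained in ys is not longer than ys,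
  -- since sending each position of xs to a position of its element in ys
  -- is injective.
  unique⊆⇒length≤ : ∀ {xs ys : List A} → Unique xs → xs ⊆ ys → length xs ≤ length ys
  unique⊆⇒length≤ {xs} {ys} u xs⊆ys = injective⇒≤ {f = position} position-injective
    where
    position : Fin (length xs) → Fin (length ys)
    position i = index (xs⊆ys (∈-lookup i))

    lookup-position : ∀ i → lookup xs i ≡ lookup ys (position i)
    lookup-position i = lookup-index (xs⊆ys (∈-lookup i))

    position-injective : ∀ {i j} → position i ≡ position j → i ≡ j
    position-injective {i} {j} eq = lookup-injective u i j (begin
      lookup xs i            ≡⟨ lookup-position i ⟩
      lookup ys (position i) ≡⟨ cong (lookup ys) eq ⟩
      lookup ys (position j) ≡⟨ sym (lookup-position j) ⟩
      lookup xs j            ∎)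
      where open ≡-Reasoning

-- Ascending lo hi xs : xs is strictly increasing with entries in [lo , hi).
-- The interval bounds make such lists closed under adjacent concatenation.
data Ascending : ℕ → ℕ → List ℕ → Set where
  []  : ∀ {lo hi} → lo ≤ hi → Ascending lo hi []
  _∷_ : ∀ {lo hi x xs} → lo ≤ x → Ascending (suc x) hi xs → Ascending lo hi (x ∷ xs)

ascending-weaken : ∀ {lo lo' hi xs} → lo ≤ lo' → Ascending lo' hi xs → Ascending lo hi xs
ascending-weaken lo≤lo' ([] lo'≤hi) = [] (≤-trans lo≤lo' lo'≤hi)
ascending-weaken lo≤lo' (lo'≤x ∷ xs↑) = ≤-trans lo≤lo' lo'≤x ∷ xs↑

ascending-++ : ∀ {lo mid hi xs ys} → Ascending lo mid xs → Ascending mid hi ys → Ascending lo hi (xs ++ ys)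
ascending-++ ([] lo≤mid) ys↑ = ascending-weaken lo≤mid ys↑
ascending-++ (lo≤x ∷ xs↑) ys↑ = lo≤x ∷ ascending-++ xs↑ ys↑

ascending-lower : ∀ {lo hi xs} → Ascending lo hi xs → All (lo ≤_) xs
ascending-lower ([] _) = []
ascending-lower (lo≤x ∷ xs↑) = lo≤x ∷ All.map (≤-trans (m≤n⇒m≤1+n lo≤x)) (ascending-lower xs↑)

ascending⇒unique : ∀ {lo hi xs} → Ascending lo hi xs → Unique xs
ascending⇒unique ([] _) = []
ascending⇒unique (_ ∷ xs↑) = All.map <⇒≢ (ascending-lower xs↑) ∷ ascending⇒unique xs↑

module _ {L : Set} where

  lowerEnds : TopTree L → List ℕ
  lowerEnds (leaf _ _ c _) = [ c ]
  lowerEnds (merge _ A B) = lowerEnds A ++ lowerEnds B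

  topSize-leaves : ∀ t → suc (topSize t) ≡ 2 * length (lowerEnds t)
  topSize-leaves (leaf _ _ _ _) = refl
  topSize-leaves (merge _ A B) = begin
    suc (suc (topSize A + topSize B))                  ≡⟨ cong suc (sym (+-suc (topSize A) (topSize B))) ⟩
    suc (topSize A) + suc (topSize B)                  ≡⟨ cong₂ _+_ (topSize-leaves A) (topSize-leaves B) ⟩
    2 * length (lowerEnds A) + 2 * length (lowerEnds B) ≡⟨ sym (*-distribˡ-+ 2 (length (lowerEnds A)) (length (lowerEnds B))) ⟩
    2 * (length (lowerEnds A) + length (lowerEnds B))  ≡⟨ cong (2 *_) (sym (length-++ (lowerEnds A))) ⟩
    2 * length (lowerEnds A ++ lowerEnds B)            ∎
    where open ≡-Reasoning

  lowerEnds⊆endpoints : ∀ t → lowerEnds t ⊆ endpoints t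
  lowerEnds⊆endpoints (leaf _ _ _ _) (here eq) = there (here eq)
  lowerEnds⊆endpoints (merge _ A B) z∈ with ∈-++⁻ (lowerEnds A) z∈
  ... | inj₁ z∈A = ∈-++⁺ˡ (lowerEnds⊆endpoints A z∈A)
  ... | inj₂ z∈B = ∈-++⁺ʳ (endpoints A) (lowerEnds⊆endpoints B z∈B)

  topSize≤2*clusterSize : ∀ t → Unique (lowerEnds t) → topSize t ≤ 2 * clusterSize t
  topSize≤2*clusterSize t u = begin
    topSize t                ≤⟨ n≤1+n (topSize t) ⟩
    suc (topSize t)          ≡⟨ topSize-leaves t ⟩
    2 * length (lowerEnds t) ≤⟨ *-monoʳ-≤ 2 (unique⊆⇒length≤ u lowerEnds⊆C) ⟩
    2 * clusterSize t        ∎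
    where
    open ≤-Reasoning
    lowerEnds⊆C : lowerEnds t ⊆ deduplicate _≟_ (endpoints t)
    lowerEnds⊆C z∈ = ∈-deduplicate⁺ _≟_ (lowerEnds⊆endpoints t z∈)

  -- The edges of a subcluster are among those of the whole tree.
  unique-⊑ : ∀ {c t : TopTree L} → c ⊑ t → Unique (lowerEnds t) → Unique (lowerEnds c)
  unique-⊑ here u = u
  unique-⊑ (left {A = A} c⊑A) u = unique-⊑ c⊑A (unique-++⁻ˡ (lowerEnds A) u)
  unique-⊑ (right {A = A} c⊑B) u = unique-⊑ c⊑B (unique-++⁻ʳ (lowerEnds A) u)

-- The greedy construction preserves the multiset of lower endpoints.

module GreedyInvariant {L : Set} where
  open Greedy {L}

  mutual
    auxEnds : Aux L → List ℕ
    auxEnds (anode es) = edgesEnds es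

    edgesEnds : List AEdge → List ℕ
    edgesEnds [] = []
    edgesEnds (e ∷ es) = edgeEnds e ++ edgesEnds es

    edgeEnds : AEdge → List ℕ
    edgeEnds (K , _ , a) = lowerEnds K ++ auxEnds a

  edgesEnds-++ : ∀ xs ys → edgesEnds (xs ++ ys) ≡ edgesEnds xs ++ edgesEnds ys
  edgesEnds-++ [] ys = refl
  edgesEnds-++ (x ∷ xs) ys = begin
    edgeEnds x ++ edgesEnds (xs ++ ys)            ≡⟨ cong (edgeEnds x ++_) (edgesEnds-++ xs ys) ⟩
    edgeEnds x ++ (edgesEnds xs ++ edgesEnds ys)  ≡⟨ sym (++-assoc (edgeEnds x) (edgesEnds xs) (edgesEnds ys)) ⟩
    (edgeEnds x ++ edgesEnds xs) ++ edgesEnds ys  ∎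
    where open ≡-Reasoning

  -- Step 1.  A horizontal merge of a non-leaf edge with a leaf edge keeps
  -- the subtree below the non-leaf one.
  hmerge-nonleaf-leaf : ∀ A f e es B g →
    edgesEnds [ hmerge (A , f , anode (e ∷ es)) (B , g , anode []) ]
      ↭ edgesEnds ((A , f , anode (e ∷ es)) ∷ (B , g , anode []) ∷ [])
  hmerge-nonleaf-leaf A f e es B g =
    solve 3 (λ a b s → ((a ⊕ b) ⊕ s) ⊕ id ⊜ (a ⊕ s) ⊕ ((b ⊕ id) ⊕ id)) ↭-refl
      (lowerEnds A) (lowerEnds B) (edgesEnds (e ∷ es))

  hpair-ends : ∀ x y → edgesEnds (hpair x y) ↭ edgesEnds (x ∷ y ∷ [])
  hpair-ends (A , f , anode []) (B , g , anode []) =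
    solve 2 (λ a b → ((a ⊕ b) ⊕ id) ⊕ id ⊜ (a ⊕ id) ⊕ ((b ⊕ id) ⊕ id)) ↭-refl
      (lowerEnds A) (lowerEnds B)
  hpair-ends (A , f , anode []) (B , g , anode (e ∷ es)) =
    solve 3 (λ a b s → ((a ⊕ b) ⊕ s) ⊕ id ⊜ (a ⊕ id) ⊕ ((b ⊕ s) ⊕ id)) ↭-refl
      (lowerEnds A) (lowerEnds B) (edgesEnds (e ∷ es))
  hpair-ends (A , f , anode (e ∷ es)) (B , g , anode []) = hmerge-nonleaf-leaf A f e es B g
  hpair-ends (_ , _ , anode (_ ∷ _)) (_ , _ , anode (_ ∷ _)) = ↭-refl

  hpair-++ : ∀ x y {zs zs'} → edgesEnds zs ↭ edgesEnds zs' → edgesEnds (hpair x y ++ zs) ↭ edgesEnds (x ∷ y ∷ zs')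
  hpair-++ x y {zs} {zs'} zs↭zs' = begin
    edgesEnds (hpair x y ++ zs)               ≡⟨ edgesEnds-++ (hpair x y) zs ⟩
    edgesEnds (hpair x y) ++ edgesEnds zs     ↭⟨ ++⁺ (hpair-ends x y) zs↭zs' ⟩
    edgesEnds (x ∷ y ∷ []) ++ edgesEnds zs'   ≡⟨ edgesEnds-++ (x ∷ y ∷ []) zs' ⟨
    edgesEnds (x ∷ y ∷ zs')                   ∎
    where open PermutationReasoning

  -- In the three-children case the
  -- clauses are split on which children are leaves so that the test in
  -- step1L computes; only a non-leaf, non-leaf, leaf triple merges the
  -- last two.
  step1L-ends : ∀ es → edgesEnds (step1L es) ↭ edgesEnds es
  step1L-ends [] = ↭-refl
  step1L-ends (x ∷ []) = ↭-refl
  step1L-ends (x ∷ y ∷ []) = hpair-ends x y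
  step1L-ends (x@(_ , _ , anode []) ∷ y ∷ z ∷ []) = hpair-++ x y {[ z ]} {[ z ]} ↭-refl
  step1L-ends (x@(_ , _ , anode (_ ∷ _)) ∷ y@(_ , _ , anode []) ∷ z ∷ []) = hpair-++ x y {[ z ]} {[ z ]} ↭-refl
  step1L-ends (x@(_ , _ , anode (_ ∷ _)) ∷ y@(_ , _ , anode (_ ∷ _)) ∷ z@(_ , _ , anode (_ ∷ _)) ∷ []) =
    hpair-++ x y {[ z ]} {[ z ]} ↭-refl
  step1L-ends (x@(_ , _ , anode (_ ∷ _)) ∷ (B , g , anode (e ∷ es)) ∷ (C , h , anode []) ∷ []) =
    ++⁺ˡ (edgeEnds x) (hmerge-nonleaf-leaf B g e es C h)
  step1L-ends (x ∷ y ∷ rest@(_ ∷ _ ∷ _)) = hpair-++ x y {step1L rest} {rest} (step1L-ends rest)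

  mutual
    step1-ends : ∀ a → auxEnds (step1 a) ↭ auxEnds a
    step1-ends (anode es) = ↭-trans (step1L-ends (step1Es es)) (step1Es-ends es)

    step1Es-ends : ∀ es → edgesEnds (step1Es es) ↭ edgesEnds es
    step1Es-ends [] = ↭-refl
    step1Es-ends ((K , _ , a) ∷ es) = ++⁺ (++⁺ˡ (lowerEnds K) (step1-ends a)) (step1Es-ends es)

  pathEnds : List (TopTree L × Bool) → List ℕ
  pathEnds [] = []
  pathEnds ((K , _) ∷ ps) = lowerEnds K ++ pathEnds ps

  clustersEnds : List (TopTree L) → List ℕ
  clustersEnds [] = []
  clustersEnds (c ∷ cs) = lowerEnds c ++ clustersEnds cs

  clustersEnds⁺ : List⁺ (TopTree L) → List ℕ
  clustersEnds⁺ (c ∷₁ cs) = lowerEnds c ++ clustersEnds cs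

  clustersEnds⁺-∷⁺ : ∀ c cs → clustersEnds⁺ (c ∷⁺ cs) ≡ lowerEnds c ++ clustersEnds⁺ cs
  clustersEnds⁺-∷⁺ c (_ ∷₁ _) = refl

  vm-ends : ∀ b e acc → clustersEnds⁺ (vm b e acc) ↭ pathEnds (e ∷ acc)
  vm-ends b (B , _) [] = ↭-refl
  vm-ends b (B , _) ((A , true) ∷ []) = ↭-refl
  vm-ends b (B , _) ((A , false) ∷ []) =
    solve 2 (λ a b → (a ⊕ b) ⊕ id ⊜ b ⊕ (a ⊕ id)) ↭-refl (lowerEnds A) (lowerEnds B)
  vm-ends b (B , _) ((A , _) ∷ x ∷ rest) rewrite clustersEnds⁺-∷⁺ (merge (vtype b) A B) (vm true x rest) =
    ↭-trans (++⁺ˡ (lowerEnds A ++ lowerEnds B) (vm-ends true x rest))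
      (solve 3 (λ a b r → (a ⊕ b) ⊕ r ⊜ b ⊕ (a ⊕ r)) ↭-refl (lowerEnds A) (lowerEnds B) (pathEnds (x ∷ rest)))

  rebuild-ends : ∀ c cs bot → edgeEnds (rebuild c cs bot) ↭ clustersEnds⁺ (c ∷₁ cs) ++ auxEnds bot
  rebuild-ends c [] bot =
    solve 2 (λ a b → a ⊕ b ⊜ (a ⊕ id) ⊕ b) ↭-refl (lowerEnds c) (auxEnds bot)
  rebuild-ends c (c' ∷ cs) bot =
    ↭-trans (rebuild-ends c' cs (anode [ (c , false , bot) ]))
      (solve 4 (λ a b d e → (b ⊕ d) ⊕ ((a ⊕ e) ⊕ id) ⊜ (a ⊕ (b ⊕ d)) ⊕ e) ↭-refl
        (lowerEnds c) (lowerEnds c') (clustersEnds cs) (auxEnds bot))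

  rebuild⁺-ends : ∀ cs bot → edgeEnds (rebuild⁺ cs bot) ↭ clustersEnds⁺ cs ++ auxEnds bot
  rebuild⁺-ends (c ∷₁ cs) bot = rebuild-ends c cs bot

  mutual
    step2Es-ends : ∀ es → edgesEnds (step2Es es) ↭ edgesEnds es
    step2Es-ends [] = ↭-refl
    step2Es-ends ((K , f , a) ∷ es) =
      ++⁺ (↭-trans (chain-ends (K , f) [] a)
             (solve 2 (λ k x → (k ⊕ id) ⊕ x ⊜ k ⊕ x) ↭-refl (lowerEnds K) (auxEnds a)))
          (step2Es-ends es)

    chain-ends : ∀ e acc a → edgeEnds (chain e acc a) ↭ pathEnds (e ∷ acc) ++ auxEnds a
    chain-ends e acc (anode ((K , f , a) ∷ [])) =
      ↭-trans (chain-ends (K , f) (e ∷ acc) a)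
        (solve 3 (λ k p r → (k ⊕ p) ⊕ r ⊜ p ⊕ ((k ⊕ r) ⊕ id)) ↭-refl
          (lowerEnds K) (pathEnds (e ∷ acc)) (auxEnds a))
    chain-ends e acc (anode []) =
      ↭-trans (rebuild⁺-ends (vm false e acc) (anode [])) (++⁺ʳ [] (vm-ends false e acc))
    chain-ends e acc (anode es@(_ ∷ _ ∷ _)) =
      ↭-trans (rebuild⁺-ends (vm true e acc) (anode (step2Es es))) (++⁺ (vm-ends true e acc) (step2Es-ends es))

  iteration-ends : ∀ a → auxEnds (iteration a) ↭ auxEnds a
  iteration-ends a@(anode es) = ↭-trans (step2Es-ends (step1L (step1Es es))) (step1-ends a)

  -- The final top tree carries exactly the lower endpoints of T̃.  The
  -- clauses follow the case split of run: either T̃ is a single edge to a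
  -- leaf, or one more iteration is performed.
  mutual
    run-ends : ∀ n a K → run n a ≡ just K → lowerEnds K ↭ auxEnds a
    run-ends n (anode ((K , _ , anode []) ∷ [])) .K refl =
      solve 1 (λ k → k ⊜ (k ⊕ id) ⊕ id) ↭-refl (lowerEnds K)
    run-ends (suc n) a@(anode []) K eq = iterate-ends n a K eq
    run-ends (suc n) a@(anode ((_ , _ , anode (_ ∷ _)) ∷ [])) K eq = iterate-ends n a K eq
    run-ends (suc n) a@(anode ((_ , _ , anode []) ∷ _ ∷ _)) K eq = iterate-ends n a K eq
    run-ends (suc n) a@(anode ((_ , _ , anode (_ ∷ _)) ∷ _ ∷ _)) K eq = iterate-ends n a K eq
    run-ends zero (anode []) K ()
    run-ends zero (anode ((_ , _ , anode (_ ∷ _)) ∷ [])) K ()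
    run-ends zero (anode ((_ , _ , anode []) ∷ _ ∷ _)) K ()
    run-ends zero (anode ((_ , _ , anode (_ ∷ _)) ∷ _ ∷ _)) K ()

    iterate-ends : ∀ n a K → run n (iteration a) ≡ just K → lowerEnds K ↭ auxEnds a
    iterate-ends n a K eq = ↭-trans (run-ends n (iteration a) K eq) (iteration-ends a)

  mutual
    initN-ascending : ∀ n l ts → Ascending (suc n) (proj₂ (initN n l ts)) (auxEnds (proj₁ (initN n l ts)))
    initN-ascending n l ts = initF-ascending n l (suc n) ts

    initF-ascending : ∀ p pl n ts → Ascending n (proj₂ (initF p pl n ts)) (edgesEnds (proj₁ (initF p pl n ts)))
    initF-ascending p pl n [] = [] ≤-refl
    initF-ascending p pl n (node l ts ∷ rest) =
      ≤-refl ∷ ascending-++ (initN-ascending n l ts) (initF-ascending p pl _ rest)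

  greedy-unique : ∀ T {𝒯} → greedyTopTree T ≡ just 𝒯 → Unique (lowerEnds 𝒯)
  greedy-unique T@(node l ts) {𝒯} eq =
    unique-resp-↭ (↭-sym (run-ends (treeSize T) (initAux T) 𝒯 eq))
      (ascending⇒unique (initN-ascending 0 l ts))

open GreedyInvariant using (greedy-unique)

lemma2 : Σ ℕ (λ K → {L : Set} (T : Tree L) (𝒯 c : TopTree L) →
           greedyTopTree T ≡ just 𝒯 → c ⊑ 𝒯 → topSize c ≤ K * clusterSize c)
lemma2 = 2 , λ T 𝒯 c greedy c⊑𝒯 → topSize≤2*clusterSize c (unique-⊑ c⊑𝒯 (greedy-unique T greedy))
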